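{- Let $G$ be a finite simple bipartite graph. Then the graph $G^{\bowtie}$ is isomorphic to the cartesian product $G\times P_2$.
   Context: For a graph $G$, $G^{\bowtie}$ is the graph with vertex set $V(G)\times\{+,-\}$ and edge set $\{\{(v,+),(w,-)\} \mid w\in N_G[v]\}$, where $N_G[v]$ is $v$ together with its neighbors. $P_2$ is the path graph with vertices $1,2$ and one edge. The cartesian product $G\times H$ has vertex set $V(G)\times V(H)$, with $(v,w)$ adjacent to $(v',w')$ iff ($v=v'$ and $w\sim_H w'$) or ($v\sim_G v'$ and $w=w'$). -}

module Defs where

open import Level using (0ℓ)
open import Data.Nat using (ℕ)
open import Data.Fin using (Fin)
open import Data.Bool using (Bool; true; false)
open import Data.Product using (_×_; _,_; Σ)
open import Data.Sum using (_⊎_)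
open import Data.Empty using (⊥)
open import Relation.Nullary using (¬_; Dec)
open import Relation.Binary.PropositionalEquality using (_≡_)
open import Function.Bundles using (_↔_; Inverse)

record Graph (V : Set) : Set₁ where
  field
    Adj     : V → V → Set
    sym     : ∀ {v w} → Adj v w → Adj w v
    irrefl  : ∀ {v} → ¬ Adj v v
open Graph public

record FinGraph : Set₁ where
  field
    n     : ℕ
    graph : Graph (Fin n)
    adj?  : ∀ v w → Dec (Adj graph v w)
open FinGraph public

IsBipartite : ∀ {V} → Graph V → Set
IsBipartite {V} G = Σ (V → Bool) λ c → ∀ {v w} → Adj G v w → ¬ (c v ≡ c w)

InClosedNbhd : ∀ {V} → Graph V → V → V → Set
InClosedNbhd G v w = (w ≡ v) ⊎ Adj G v w

-- G^⋈ : vertex set V × {+,-} (true = +, false = -),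
-- edges {(v,+),(w,-)} with w ∈ N_G[v].
BowtieAdj : ∀ {V} → Graph V → V × Bool → V × Bool → Set
BowtieAdj G (v , true)  (w , false) = InClosedNbhd G v w
BowtieAdj G (v , false) (w , true)  = InClosedNbhd G w v
BowtieAdj G (v , true)  (w , true)  = ⊥
BowtieAdj G (v , false) (w , false) = ⊥

bowtie : ∀ {V} → Graph V → Graph (V × Bool)
bowtie G = record { Adj = BowtieAdj G ; sym = s ; irrefl = i }
  where
  s : ∀ {x y} → BowtieAdj G x y → BowtieAdj G y x
  s {v , true}  {w , false} p = p
  s {v , false} {w , true}  p = p
  i : ∀ {x} → ¬ BowtieAdj G x x
  i {v , true}  ()
  i {v , false} ()

P2Adj : Fin 2 → Fin 2 → Set
P2Adj x y = ¬ (x ≡ y)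

P2 : Graph (Fin 2)
P2 = record { Adj = P2Adj ; sym = λ p q → p (Relation.Binary.PropositionalEquality.sym q) ; irrefl = λ p → p Relation.Binary.PropositionalEquality.refl }

ProdAdj : ∀ {V W} → Graph V → Graph W → V × W → V × W → Set
ProdAdj G H (v , w) (v' , w') = (v ≡ v' × Adj H w w') ⊎ (Adj G v v' × w ≡ w')

_□_ : ∀ {V W} → Graph V → Graph W → Graph (V × W)
G □ H = record { Adj = ProdAdj G H ; sym = s ; irrefl = i }
  where
  open Relation.Binary.PropositionalEquality using () renaming (sym to ≡sym)
  s : ∀ {x y} → ProdAdj G H x y → ProdAdj G H y x
  s (Data.Sum.inj₁ (e , a)) = Data.Sum.inj₁ (≡sym e , Graph.sym H a)
  s (Data.Sum.inj₂ (a , e)) = Data.Sum.inj₂ (Graph.sym G a , ≡sym e)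
  i : ∀ {x} → ¬ ProdAdj G H x x
  i (Data.Sum.inj₁ (_ , a)) = Graph.irrefl H a
  i (Data.Sum.inj₂ (a , _)) = Graph.irrefl G a

record _≅_ {V W} (G : Graph V) (H : Graph W) : Set where
  field
    bij      : V ↔ W
    preserve : ∀ x y → Adj G x y → Adj H (Inverse.to bij x) (Inverse.to bij y)
    reflect  : ∀ x y → Adj H (Inverse.to bij x) (Inverse.to bij y) → Adj G x y

-- Twist the sign of every vertex by its colour, (v , s) ↦ (v , c v xor s).
-- The edge (v,+)(v,-) of G^⋈ then joins the two copies of v in G × P₂, and
-- for an edge vw of G the colours of v and w differ, so (v,+) and (w,-) land
-- in the same copy of G.  Conversely, G^⋈ has no edges within a sign class,
-- and neither do their images, because the colouring is proper.
module Submission where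

open import Defs hiding (sym)
open import Data.Bool using (Bool; true; false; not; _xor_)
open import Data.Bool.Properties
  using (xor-comm; not-involutive; not-distribˡ-xor; not-distribʳ-xor; ¬-not)
open import Data.Fin using (Fin)
open import Data.Fin.Properties using (2↔Bool)
open import Data.Product using (_×_; _,_)
open import Data.Sum using (inj₁; inj₂)
open import Function using (_∘_)
open import Function.Bundles using (_↔_; Inverse; Injection; mk↔ₛ′)
open import Function.Properties.Inverse using (↔-sym; Inverse⇒Injection)
open import Relation.Nullary using (¬_)
open import Relation.Binary.PropositionalEquality
  using (_≡_; _≢_; refl; sym; trans; cong; cong₂; module ≡-Reasoning)

xor-cancelˡ : ∀ a s → a xor (a xor s) ≡ s
xor-cancelˡ false s = refl
xor-cancelˡ true  s = not-involutive s

xor-injectiveʳ : ∀ a {s t} → a xor s ≡ a xor t → s ≡ t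
xor-injectiveʳ a {s} {t} e =
  trans (sym (xor-cancelˡ a s)) (trans (cong (a xor_) e) (xor-cancelˡ a t))

xor-injectiveˡ : ∀ s {a b} → a xor s ≡ b xor s → a ≡ b
xor-injectiveˡ s {a} {b} e =
  xor-injectiveʳ s (trans (xor-comm s a) (trans e (xor-comm b s)))

xor-≢ʳ : ∀ a {s t} → s ≢ t → a xor s ≢ a xor t
xor-≢ʳ a s≢t = s≢t ∘ xor-injectiveʳ a

xor-≢-≢ : ∀ {a b s t} → a ≢ b → s ≢ t → a xor s ≡ b xor t
xor-≢-≢ {a} {b} {s} {t} a≢b s≢t = begin
  a xor s             ≡⟨ sym (not-involutive _) ⟩
  not (not (a xor s)) ≡⟨ cong not (not-distribʳ-xor a s) ⟩
  not (a xor not s)   ≡⟨ not-distribˡ-xor a (not s) ⟩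
  not a xor not s     ≡⟨ cong₂ _xor_ (sym (¬-not (a≢b ∘ sym))) (sym (¬-not (s≢t ∘ sym))) ⟩
  b xor t             ∎
  where open ≡-Reasoning

bit : Bool → Fin 2
bit = Inverse.from 2↔Bool

bit-injective : ∀ {x y} → bit x ≡ bit y → x ≡ y
bit-injective = Injection.injective (Inverse⇒Injection (↔-sym 2↔Bool))

bit-≢ : ∀ {x y} → x ≢ y → P2Adj (bit x) (bit y)
bit-≢ x≢y e = x≢y (bit-injective e)

twist : {V : Set} → (V → Bool) → (V × Bool) ↔ (V × Fin 2)
twist {V} c = mk↔ₛ′ to from to∘from from∘to
  where
  to : V × Bool → V × Fin 2
  to (v , s) = v , bit (c v xor s)

  from : V × Fin 2 → V × Bool
  from (v , k) = v , c v xor Inverse.to 2↔Bool k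

  to∘from : ∀ y → to (from y) ≡ y
  to∘from (v , k) = cong (v ,_) (begin
    bit (c v xor (c v xor Inverse.to 2↔Bool k)) ≡⟨ cong bit (xor-cancelˡ (c v) _) ⟩
    bit (Inverse.to 2↔Bool k)                   ≡⟨ Inverse.strictlyInverseʳ 2↔Bool k ⟩
    k                                           ∎)
    where open ≡-Reasoning

  from∘to : ∀ x → from (to x) ≡ x
  from∘to (v , s) = cong (v ,_) (begin
    c v xor Inverse.to 2↔Bool (bit (c v xor s)) ≡⟨ cong (c v xor_) (Inverse.strictlyInverseˡ 2↔Bool _) ⟩
    c v xor (c v xor s)                         ≡⟨ xor-cancelˡ (c v) s ⟩
    s                                           ∎)
    where open ≡-Reasoning

module _ {V : Set} (G : Graph V) (c : V → Bool)
         (proper : ∀ {v w} → Adj G v w → ¬ (c v ≡ c w)) where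

  private
    φ : V × Bool → V × Fin 2
    φ = Inverse.to (twist c)

  twist-preserves : ∀ x y → BowtieAdj G x y → ProdAdj G P2 (φ x) (φ y)
  twist-preserves (v , true)  (w , false) (inj₁ refl) = inj₁ (refl , bit-≢ (xor-≢ʳ (c v) λ ()))
  twist-preserves (v , true)  (w , false) (inj₂ vw)   = inj₂ (vw , cong bit (xor-≢-≢ (proper vw) λ ()))
  twist-preserves (v , false) (w , true)  (inj₁ refl) = inj₁ (refl , bit-≢ (xor-≢ʳ (c v) λ ()))
  twist-preserves (v , false) (w , true)  (inj₂ wv)   =
    inj₂ (Graph.sym G wv , cong bit (xor-≢-≢ (proper (Graph.sym G wv)) λ ()))

  twist-sameSign-nonadjacent : ∀ v w s → ¬ ProdAdj G P2 (φ (v , s)) (φ (w , s))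
  twist-sameSign-nonadjacent v w s (inj₁ (refl , p)) = p refl
  twist-sameSign-nonadjacent v w s (inj₂ (vw , e))   = proper vw (xor-injectiveˡ s (bit-injective e))

  twist-reflects : ∀ x y → ProdAdj G P2 (φ x) (φ y) → BowtieAdj G x y
  twist-reflects (v , true)  (w , false) (inj₁ (v≡w , _)) = inj₁ (sym v≡w)
  twist-reflects (v , true)  (w , false) (inj₂ (vw , _))  = inj₂ vw
  twist-reflects (v , false) (w , true)  (inj₁ (v≡w , _)) = inj₁ v≡w
  twist-reflects (v , false) (w , true)  (inj₂ (vw , _))  = inj₂ (Graph.sym G vw)
  twist-reflects (v , true)  (w , true)  p = twist-sameSign-nonadjacent v w true p
  twist-reflects (v , false) (w , false) p = twist-sameSign-nonadjacent v w false p

bowtie≅□P2 : {V : Set} (G : Graph V) → IsBipartite G → bowtie G ≅ (G □ P2)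
bowtie≅□P2 G (c , proper) = record
  { bij      = twist c
  ; preserve = twist-preserves G c proper
  ; reflect  = twist-reflects G c proper
  }

lemma5p5 : (G : FinGraph) → IsBipartite (graph G) →
    bowtie (graph G) ≅ (graph G □ P2)
lemma5p5 G = bowtie≅□P2 (graph G)
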